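{- Let $B$ and $C$ be predomain bases on which consistency is continuous, and suppose $C$ has weak interpolation. Then every Scott continuous map $f:B\to\hat C$ has a Scott continuous extension $\hat f:\hat B\to\hat C$, i.e. $\hat f$ is Scott continuous and $\hat f(b)=f(b)$ for all $b\in B$ (where $b$ is identified with its canonical embedding in $\hat B$).
   Context: Work constructively; $\tilde\exists x.A$ abbreviates $\neg\forall x.\neg A$. In a poset, a chain is a sequence $(x_n)$ with $x_n\sqsubseteq x_{n+1}$; $b\ll c$ means: for every chain $(x_n)$ whose supremum exists and satisfies $c\sqsubseteq\bigsqcup_n x_n$, there weakly exists $n$ with $b\sqsubseteq x_n$. An approximating sequence of $b$ is a chain $(b_n)$ with $b_n\ll b$ for all $n$ and $\bigsqcup_n b_n=b$. A predomain base is a countable poset with decidable order in which every element has an approximating sequence. A nonempty finite subset is consistent if it weakly has an upper bound. Consistency is continuous if for every nonempty finite $I$ and elements $a_i=\bigsqcup_j a_{i,j}$ ($i\in I$, each $(a_{i,j})_j$ a chain) such that $\{a_{i,j}\mid i\in I\}$ is consistent for every $j$, the set $\{a_i\mid i\in I\}$ is consistent. $C$ has weak interpolation if whenever $M\subseteq C$ is finite and $x\ll z$ for all $x\in M$, there weakly exists $y$ with $x\ll y\ll z$ for all $x\in M$. The continuous completion $\hat B$ is the set of increasing sequences in $B$, preordered by $(b_n)\sqsubseteq(b'_n)$ iff for all $b\in B$, $n$, $b\ll b_n$ implies $\tilde\exists m.\,b\ll b'_m$; equality is mutual $\sqsubseteq$. The canonical embedding sends $b\in B$ to the constant sequence $(b)_n$.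 A monotone map $h$ between posets is Scott continuous if $h(\bigsqcup_n x_n)=\bigsqcup_n h(x_n)$ for all chains whenever these suprema exist. -}

module Defs where

open import Level using (0ℓ)
open import Data.Nat using (ℕ; suc)
open import Data.Fin using (Fin)
open import Data.Product using (Σ; ∃; _×_; _,_; proj₁; proj₂)
open import Relation.Nullary using (¬_)
open import Relation.Binary using (Poset; IsPartialOrder; IsPreorder; IsEquivalence; Decidable)
open import Relation.Binary.PropositionalEquality using (_≡_)

∃̃ : {A : Set} → (A → Set) → Set
∃̃ {A} P = ¬ ((x : A) → ¬ P x)

module _ (P : Poset 0ℓ 0ℓ 0ℓ) where
  open Poset P renaming (Carrier to X; _≤_ to _⊑_)

  IsChain : (ℕ → X) → Set
  IsChain x = (n : ℕ) → x n ⊑ x (suc n)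

  IsSup : (ℕ → X) → X → Set
  IsSup x s = ((n : ℕ) → x n ⊑ s) × ((u : X) → ((n : ℕ) → x n ⊑ u) → s ⊑ u)

  _≪_ : X → X → Set
  b ≪ c = (x : ℕ → X) → IsChain x → (s : X) → IsSup x s → c ⊑ s →
          ∃̃ (λ n → b ⊑ x n)

  IsApproxSeq : (ℕ → X) → X → Set
  IsApproxSeq x b = IsChain x × ((n : ℕ) → x n ≪ b) × IsSup x b

  Consistent : {k : ℕ} → (Fin (suc k) → X) → Set
  Consistent a = ∃̃ (λ u → ∀ i → a i ⊑ u)

  ConsistencyContinuous : Set
  ConsistencyContinuous =
    (k : ℕ) (a : Fin (suc k) → X) (aj : Fin (suc k) → ℕ → X) →
    (∀ i → IsChain (aj i)) → (∀ i → IsSup (aj i) (a i)) →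
    ((j : ℕ) → Consistent (λ i → aj i j)) →
    Consistent a

  WeakInterpolation : Set
  WeakInterpolation =
    (k : ℕ) (M : Fin k → X) (z : X) → (∀ i → M i ≪ z) →
    ∃̃ (λ y → (∀ i → M i ≪ y) × (y ≪ z))

  Countable : Set
  Countable = Σ (ℕ → X) (λ e → (x : X) → ∃ (λ n → e n ≈ x))

  record IsPredomainBase : Set where
    field
      countable : Countable
      decidable : Decidable _⊑_
      approx    : (b : X) → Σ (ℕ → X) (λ x → IsApproxSeq x b)

module _ (B : Poset 0ℓ 0ℓ 0ℓ) where
  open Poset B renaming (Carrier to X; _≤_ to _⊑_)

  HatCarrier : Set
  HatCarrier = Σ (ℕ → X) (IsChain B)

  _⊑̂_ : HatCarrier → HatCarrier → Set
  s ⊑̂ t = (b : X) (n : ℕ) → _≪_ B b (proj₁ s n) → ∃̃ (λ m → _≪_ B b (proj₁ t m))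

  _≈̂_ : HatCarrier → HatCarrier → Set
  s ≈̂ t = (s ⊑̂ t) × (t ⊑̂ s)

  private
    ⊑̂-refl : ∀ {s} → s ⊑̂ s
    ⊑̂-refl b n p k = k n p

    ⊑̂-trans : ∀ {s t u} → s ⊑̂ t → t ⊑̂ u → s ⊑̂ u
    ⊑̂-trans st tu b n p k = st b n p (λ m q → tu b m q k)

  Hat : Poset 0ℓ 0ℓ 0ℓ
  Hat = record
    { Carrier = HatCarrier
    ; _≈_ = _≈̂_
    ; _≤_ = _⊑̂_
    ; isPartialOrder = record
      { isPreorder = record
        { isEquivalence = record
          { refl = λ {s} → ⊑̂-refl {s} , ⊑̂-refl {s}
          ; sym = λ p → proj₂ p , proj₁ p
          ; trans = λ {s} {t} {u} p q → ⊑̂-trans {s} {t} {u} (proj₁ p) (proj₁ q) , ⊑̂-trans {u} {t} {s} (proj₂ q) (proj₂ p)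
          }
        ; reflexive = proj₁
        ; trans = λ {s} {t} {u} → ⊑̂-trans {s} {t} {u}
        }
      ; antisym = _,_
      }
    }

  embed : X → HatCarrier
  embed b = (λ _ → b) , (λ _ → refl)

module _ (P Q : Poset 0ℓ 0ℓ 0ℓ) where
  private
    module P = Poset P
    module Q = Poset Q

  Monotone : Set
  Monotone = Σ (P.Carrier → Q.Carrier) (λ h → ∀ {x y} → x P.≤ y → h x Q.≤ h y)

  ScottContinuous : Monotone → Set
  ScottContinuous (h , _) =
    (x : ℕ → P.Carrier) → IsChain P x →
    (s : P.Carrier) → IsSup P x s →
    (t : Q.Carrier) → IsSup Q (λ n → h (x n)) t →
    h s Q.≈ t

-- Every chain T in a completion Ĉ has a supremum: the approximants of all entries of all T j
-- form a countable, weakly directed family, and decidability of the order lets one extract from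
-- it a chain that weakly bounds each of its members.  The extension is f̂ s := ⊔ₖ f (s k).  It
-- agrees with f on the (constant) embedded sequences; it is monotone because Scott continuity
-- gives f b = ⊔ₚ f (bₚ) for an approximating sequence, so f̂ s only depends on the elements way
-- below entries of s; and it is Scott continuous because the supremum of a chain x in B̂ is
-- built from entries of the x j.
module Submission where

open import Defs hiding (_≪_; _⊑̂_)
import Defs
open import Level using (0ℓ)
open import Data.Product using (Σ; ∃; _×_; proj₁; proj₂; _,_; uncurry)
open import Relation.Binary using (Poset; Decidable)
open import Data.Nat using (ℕ; zero; suc; _+_; _≤_; _<_; z≤n; s≤s; _⊔_)
open import Data.Nat.Properties
  using (≤-refl; <-trans; ≤-<-trans; m≤m+n; m≤m⊔n; m≤n⊔m; m<1+n⇒m<n∨m≡n; +-suc; +-identityʳ)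
open import Data.Fin using (Fin; toℕ; fromℕ<)
open import Data.Fin.Properties using (any?; toℕ-fromℕ<)
open import Data.Sum using (_⊎_; inj₁; inj₂)
open import Relation.Nullary using (¬_; Dec; yes; no; contradiction)
open import Relation.Nullary.Decidable using (_×-dec_; decidable-stable)
open import Relation.Binary.PropositionalEquality using (_≡_; refl; sym; trans; cong; subst)

∃̃-intro : {A : Set} {P : A → Set} (a : A) → P a → ∃̃ P
∃̃-intro a p ¬P = ¬P a p

∃̃-bind : {A : Set} {P : A → Set} {G : Set} → ∃̃ P → ((a : A) → P a → ¬ G) → ¬ G
∃̃-bind e k g = e (λ a p → k a p g)

-- A walk along the anti-diagonals a + b = d, enumerating ℕ × ℕ.
next : ℕ × ℕ → ℕ × ℕ
next (a , zero)  = (zero , suc a)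
next (a , suc b) = (suc a , b)

unpair : ℕ → ℕ × ℕ
unpair zero    = (0 , 0)
unpair (suc n) = next (unpair n)

unpair-along-diagonal : ∀ {d} → (∃ λ n → unpair n ≡ (0 , d)) →
                        ∀ a b → a + b ≡ d → ∃ λ m → unpair m ≡ (a , b)
unpair-along-diagonal start zero b refl = start
unpair-along-diagonal start (suc a) b a+b≡d
  with unpair-along-diagonal start a (suc b) (trans (+-suc a b) a+b≡d)
... | m , eq = suc m , cong next eq

unpair-diagonal-start : ∀ d → ∃ λ n → unpair n ≡ (0 , d)
unpair-diagonal-start zero = 0 , refl
unpair-diagonal-start (suc d)
  with unpair-along-diagonal (unpair-diagonal-start d) d 0 (+-identityʳ d)
... | m , eq = suc m , cong next eq

unpair-surjective : ∀ a b → ∃ λ n → unpair n ≡ (a , b)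
unpair-surjective a b = unpair-along-diagonal (unpair-diagonal-start (a + b)) a b refl

enumerate₂ : {A : Set} → (ℕ → ℕ → A) → ℕ → A
enumerate₂ F n = uncurry F (unpair n)

enumerate₂-surjective : {A : Set} (F : ℕ → ℕ → A) → ∀ i p → ∃ λ n → enumerate₂ F n ≡ F i p
enumerate₂-surjective F i p with unpair-surjective i p
... | n , eq = n , cong (uncurry F) eq

module _ (P : Poset 0ℓ 0ℓ 0ℓ) where
  open Poset P using () renaming (Carrier to X; _≤_ to _⊑_; refl to ⊑-refl; trans to ⊑-trans)

  chain-mono : (x : ℕ → X) → IsChain P x → ∀ {m n} → m ≤ n → x m ⊑ x n
  chain-mono x x-chain {zero}  {zero}  z≤n = ⊑-refl
  chain-mono x x-chain {zero}  {suc n} z≤n = ⊑-trans (chain-mono x x-chain {zero} {n} z≤n) (x-chain n)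
  chain-mono x x-chain (s≤s m≤n) = chain-mono (λ i → x (suc i)) (λ i → x-chain (suc i)) m≤n

  row-upper-bound : (F : ℕ → ℕ → X) → (∀ k → IsChain P (F k)) →
                    ∀ k m m′ → ∃ λ n → F k m ⊑ enumerate₂ F n × F k m′ ⊑ enumerate₂ F n
  row-upper-bound F F-chain k m m′ with enumerate₂-surjective F k (m ⊔ m′)
  ... | n , eq = n , subst (F k m ⊑_) (sym eq) (chain-mono (F k) (F-chain k) (m≤m⊔n m m′))
                   , subst (F k m′ ⊑_) (sym eq) (chain-mono (F k) (F-chain k) (m≤n⊔m m m′))

-- In a poset with decidable order, a weakly directed sequence D has a chain of its members
-- that weakly bounds every member.
module CofinalChain (P : Poset 0ℓ 0ℓ 0ℓ) (_⊑?_ : Decidable (Poset._≤_ P))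
  (D : ℕ → Poset.Carrier P)
  (directed : ∀ i j → ∃̃ λ k → Poset._≤_ P (D i) (D k) × Poset._≤_ P (D j) (D k)) where
  open Poset P using () renaming (Carrier to X; _≤_ to _⊑_; refl to ⊑-refl; trans to ⊑-trans)

  Bounds : ℕ → ℕ → Set
  Bounds c r = ∀ i → i < r → D i ⊑ D c

  Joins : ℕ → ℕ → ℕ → Set
  Joins c r k = D c ⊑ D k × D r ⊑ D k

  Found : ℕ → ℕ → ℕ → Set
  Found n c r = ∃ λ (k : Fin (suc n)) → Joins c r (toℕ k)

  search : ∀ n c r → Dec (Found n c r)
  search n c r = any? (λ k → (D c ⊑? D (toℕ k)) ×-dec (D r ⊑? D (toℕ k)))

  -- The state (c , r) means: the chain sits at D c, which bounds D 0, …, D (r - 1).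
  -- A step looks for an upper bound of D c and D r among D 0, …, D n.
  move : ∀ c r {n} → Dec (Found n c r) → ℕ × ℕ
  move c r (yes (k , _)) = (toℕ k , suc r)
  move c r (no _)        = (c , r)

  step : ℕ → ℕ × ℕ → ℕ × ℕ
  step n (c , r) = move c r (search n c r)

  move-⊒ : ∀ c r {n} (d : Dec (Found n c r)) → D c ⊑ D (proj₁ (move c r d))
  move-⊒ c r (yes (_ , c⊑k , _)) = c⊑k
  move-⊒ c r (no _)              = ⊑-refl

  move-bounds : ∀ c r {n} (d : Dec (Found n c r)) →
                Bounds c r → Bounds (proj₁ (move c r d)) (proj₂ (move c r d))
  move-bounds c r (no _) bounds = bounds
  move-bounds c r (yes (_ , c⊑k , r⊑k)) bounds i i<1+r with m<1+n⇒m<n∨m≡n i<1+r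
  ... | inj₁ i<r  = ⊑-trans (bounds i i<r) c⊑k
  ... | inj₂ refl = r⊑k

  move-grows-or-stays : ∀ c r {n} (d : Dec (Found n c r)) →
                        r < proj₂ (move c r d) ⊎ move c r d ≡ (c , r)
  move-grows-or-stays c r (yes _) = inj₁ ≤-refl
  move-grows-or-stays c r (no _)  = inj₂ refl

  step-grows : ∀ n c r k → Joins c r k → k ≤ n → r < proj₂ (step n (c , r))
  step-grows n c r k joins k≤n with search n c r
  ... | yes _    = ≤-refl
  ... | no ¬found =
    contradiction (fromℕ< (s≤s k≤n) , subst (Joins c r) (sym (toℕ-fromℕ< (s≤s k≤n))) joins) ¬found

  state : ℕ → ℕ × ℕ
  state zero    = (0 , 0)
  state (suc n) = step n (state n)

  index : ℕ → ℕ
  index n = proj₁ (state n)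

  level : ℕ → ℕ
  level n = proj₂ (state n)

  search-at : ∀ n → Dec (Found n (index n) (level n))
  search-at n = search n (index n) (level n)

  chain : ℕ → X
  chain n = D (index n)

  chain-isChain : IsChain P chain
  chain-isChain n = move-⊒ (index n) (level n) (search-at n)

  chain-bounds : ∀ n → Bounds (index n) (level n)
  chain-bounds zero i ()
  chain-bounds (suc n) = move-bounds (index n) (level n) (search-at n) (chain-bounds n)

  level-grows-or-state-stays : ∀ n j → level n < level (j + n) ⊎ state (j + n) ≡ state n
  level-grows-or-state-stays n zero = inj₂ refl
  level-grows-or-state-stays n (suc j)
    with level-grows-or-state-stays n j
       | move-grows-or-stays (index (j + n)) (level (j + n)) (search-at (j + n))
  ... | inj₁ grown  | inj₁ grows = inj₁ (<-trans grown grows)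
  ... | inj₁ grown  | inj₂ stays = inj₁ (subst (λ s → level n < proj₂ s) (sym stays) grown)
  ... | inj₂ stayed | inj₁ grows = inj₁ (subst (λ s → proj₂ s < level (suc j + n)) stayed grows)
  ... | inj₂ stayed | inj₂ stays = inj₂ (trans stays stayed)

  -- Directedness weakly supplies a k joining D (index n) and D (level n); by stage k + n the
  -- level has grown, either earlier or because the search at stage k + n finds k.
  level-grows : ∀ n → ∃̃ λ n′ → level n < level n′
  level-grows n never = directed (index n) (level n) never-joins
    where
    never-joins : ∀ k → ¬ Joins (index n) (level n) k
    never-joins k joins with level-grows-or-state-stays n k
    ... | inj₁ grown  = never (k + n) grown
    ... | inj₂ stayed = never (suc k + n) (subst (λ s → level n < proj₂ (step (k + n) s)) (sym stayed)
                          (step-grows (k + n) (index n) (level n) k joins (m≤m+n k n)))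

  level-unbounded : ∀ r → ∃̃ λ n → r ≤ level n
  level-unbounded zero    = ∃̃-intro 0 z≤n
  level-unbounded (suc r) = ∃̃-bind (level-unbounded r) λ n r≤ →
                            ∃̃-bind (level-grows n) λ n′ grows → ∃̃-intro n′ (≤-<-trans r≤ grows)

  cofinal : ∀ i → ∃̃ λ n → D i ⊑ chain n
  cofinal i = ∃̃-bind (level-unbounded (suc i)) λ n i<level → ∃̃-intro n (chain-bounds n i i<level)

module PredomainBase (P : Poset 0ℓ 0ℓ 0ℓ) (base : IsPredomainBase P) where
  open Poset P using () renaming (Carrier to X; _≤_ to _⊑_; refl to ⊑-refl; trans to ⊑-trans)
  open IsPredomainBase base using (decidable; approx)

  _≪_ : X → X → Set
  _≪_ = Defs._≪_ P

  α : X → ℕ → X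
  α b = proj₁ (approx b)

  α-chain : ∀ b → IsChain P (α b)
  α-chain b = proj₁ (proj₂ (approx b))

  α-≪ : ∀ b n → α b n ≪ b
  α-≪ b = proj₁ (proj₂ (proj₂ (approx b)))

  α-sup : ∀ b → IsSup P (α b) b
  α-sup b = proj₂ (proj₂ (proj₂ (approx b)))

  ≪⇒⊑ : ∀ {a b} → a ≪ b → a ⊑ b
  ≪⇒⊑ {a} {b} a≪b = decidable-stable (decidable a b) λ a⋢b →
    a≪b (λ _ → b) (λ _ → ⊑-refl) b ((λ _ → ⊑-refl) , λ _ ub → ub 0) ⊑-refl (λ _ → a⋢b)

  ≪-⊑-trans : ∀ {a b c} → a ≪ b → b ⊑ c → a ≪ c
  ≪-⊑-trans a≪b b⊑c x x-chain s s-sup c⊑s = a≪b x x-chain s s-sup (⊑-trans b⊑c c⊑s)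

  ⊑-≪-trans : ∀ {a b c} → a ⊑ b → b ≪ c → a ≪ c
  ⊑-≪-trans a⊑b b≪c x x-chain s s-sup c⊑s never =
    b≪c x x-chain s s-sup c⊑s (λ n b⊑xn → never n (⊑-trans a⊑b b⊑xn))

  ≪-sup : ∀ {a b} {y : ℕ → X} → a ≪ b → IsChain P y → IsSup P y b → ∃̃ λ n → a ⊑ y n
  ≪-sup a≪b y-chain y-sup = a≪b _ y-chain _ y-sup ⊑-refl

  module ApproximantChain (c : ℕ → X)
    (joinable : ∀ i j {a b} → a ≪ c i → b ≪ c j → ∃̃ λ k → a ≪ c k × b ≪ c k) where

    D : ℕ → X
    D = enumerate₂ (λ i → α (c i))

    D-≪ : ∀ n → D n ≪ c (proj₁ (unpair n))
    D-≪ n = α-≪ _ _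

    directed : ∀ m n → ∃̃ λ k → D m ⊑ D k × D n ⊑ D k
    directed m n = ∃̃-bind (joinable _ _ (D-≪ m) (D-≪ n)) λ { k (m≪ , n≪) →
                   ∃̃-bind (≪-sup m≪ (α-chain _) (α-sup _)) λ p m⊑ →
                   ∃̃-bind (≪-sup n≪ (α-chain _) (α-sup _)) λ q n⊑ →
                   let (l , p⊑l , q⊑l) = row-upper-bound P (λ i → α (c i)) (λ i → α-chain (c i)) k p q
                   in ∃̃-intro l (⊑-trans m⊑ p⊑l , ⊑-trans n⊑ q⊑l) }

    open CofinalChain P decidable D directed public using (chain; chain-isChain)
    open CofinalChain P decidable D directed using (index; cofinal)

    chain-≪ : ∀ n → ∃ λ i → chain n ≪ c i
    chain-≪ n = _ , D-≪ (index n)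

    chain-cofinal : ∀ i p → ∃̃ λ n → α (c i) p ⊑ chain n
    chain-cofinal i p with enumerate₂-surjective (λ i → α (c i)) i p
    ... | m , Dm≡ = ∃̃-bind (cofinal m) λ n Dm⊑ → ∃̃-intro n (subst (_⊑ chain n) Dm≡ Dm⊑)

  -- The double approximants α (α x p) q contain a chain with supremum x.
  ≪-approximant : ∀ {a x} → a ≪ x → ∃̃ λ p → a ≪ α x p
  ≪-approximant {x = x} a≪x =
    ∃̃-bind (≪-sup a≪x chain-isChain chain-sup) λ n a⊑ →
    ∃̃-intro (proj₁ (chain-≪ n)) (⊑-≪-trans a⊑ (proj₂ (chain-≪ n)))
    where
    joinable : ∀ i j {a b} → a ≪ α x i → b ≪ α x j → ∃̃ λ k → a ≪ α x k × b ≪ α x k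
    joinable i j a≪ b≪ = ∃̃-intro (i ⊔ j)
      (≪-⊑-trans a≪ (chain-mono P (α x) (α-chain x) (m≤m⊔n i j)) ,
       ≪-⊑-trans b≪ (chain-mono P (α x) (α-chain x) (m≤n⊔m i j)))

    open ApproximantChain (α x) joinable

    chain-sup : IsSup P chain x
    chain-sup = (λ n → ⊑-trans (≪⇒⊑ (proj₂ (chain-≪ n))) (≪⇒⊑ (α-≪ x _))) ,
                λ w ub → proj₂ (α-sup x) w λ p → proj₂ (α-sup (α x p)) w λ q →
                  decidable-stable (decidable _ _)
                    (∃̃-bind (chain-cofinal p q) λ n α⊑ α⋢w → α⋢w (⊑-trans α⊑ (ub n)))

  _⊑̂_ : HatCarrier P → HatCarrier P → Set
  _⊑̂_ = Defs._⊑̂_ P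

  ⊑̂-stable : ∀ {s t} → ¬ ¬ (s ⊑̂ t) → s ⊑̂ t
  ⊑̂-stable ¬¬s⊑t b n b≪ ¬found = ¬¬s⊑t λ s⊑t → s⊑t b n b≪ ¬found

  module HatChainSup (T : ℕ → HatCarrier P) (T-chain : IsChain (Hat P) T) where

    entry : ℕ → X
    entry = enumerate₂ (λ j → proj₁ (T j))

    entries-joinable : ∀ i i′ {a b} → a ≪ entry i → b ≪ entry i′ → ∃̃ λ k → a ≪ entry k × b ≪ entry k
    entries-joinable i i′ a≪ b≪ =
      ∃̃-bind (T-mono (m≤m⊔n j j′) _ _ a≪) λ m a≪Tm →
      ∃̃-bind (T-mono (m≤n⊔m j j′) _ _ b≪) λ m′ b≪Tm′ →
      let (k , m⊑k , m′⊑k) = row-upper-bound P (λ j → proj₁ (T j)) (λ j → proj₂ (T j)) (j ⊔ j′) m m′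
      in ∃̃-intro k (≪-⊑-trans a≪Tm m⊑k , ≪-⊑-trans b≪Tm′ m′⊑k)
      where
      j = proj₁ (unpair i)
      j′ = proj₁ (unpair i′)
      T-mono : ∀ {m n} → m ≤ n → T m ⊑̂ T n
      T-mono = chain-mono (Hat P) T T-chain

    open ApproximantChain entry entries-joinable

    sup : HatCarrier P
    sup = chain , chain-isChain

    sup-below : ∀ n → Σ ℕ λ j → Σ ℕ λ l → proj₁ sup n ⊑ proj₁ (T j) l
    sup-below n = _ , _ , ≪⇒⊑ (proj₂ (chain-≪ n))

    upper : ∀ j → T j ⊑̂ sup
    upper j b l b≪ with enumerate₂-surjective (λ j → proj₁ (T j)) j l
    ... | i , entry-i≡ =
      ∃̃-bind (≪-approximant b≪) λ p b≪α →
      ∃̃-bind (chain-cofinal i p) λ n α⊑ →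
      ∃̃-intro n (≪-⊑-trans b≪α (subst (λ e → α e p ⊑ chain n) entry-i≡ α⊑))

    least : ∀ v → (∀ j → T j ⊑̂ v) → sup ⊑̂ v
    least v ub b n b≪ with sup-below n
    ... | j , l , below = ub j b l (≪-⊑-trans b≪ below)

    isSup : IsSup (Hat P) T sup
    isSup = upper , least

module Extension (B C : Poset 0ℓ 0ℓ 0ℓ) (baseB : IsPredomainBase B) (baseC : IsPredomainBase C)
  (f : Monotone B (Hat C)) (f-continuous : ScottContinuous B (Hat C) f) where
  private
    module B = PredomainBase B baseB
    module C = PredomainBase C baseC
  open Poset B using () renaming (Carrier to XB; _≤_ to _⊑_)
  open Poset (Hat C) using () renaming (refl to ⊑̂-refl; trans to ⊑̂-trans)
  open C using (_⊑̂_; ⊑̂-stable)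

  f₀ : XB → HatCarrier C
  f₀ = proj₁ f

  f-mono : ∀ {a b} → a ⊑ b → f₀ a ⊑̂ f₀ b
  f-mono = proj₂ f

  images : HatCarrier B → ℕ → HatCarrier C
  images s k = f₀ (proj₁ s k)

  images-chain : ∀ s → IsChain (Hat C) (images s)
  images-chain s k = f-mono (proj₂ s k)

  f̂ : HatCarrier B → HatCarrier C
  f̂ s = C.HatChainSup.sup (images s) (images-chain s)

  f̂-upper : ∀ s k → f₀ (proj₁ s k) ⊑̂ f̂ s
  f̂-upper s = C.HatChainSup.upper (images s) (images-chain s)

  f̂-least : ∀ s v → (∀ k → f₀ (proj₁ s k) ⊑̂ v) → f̂ s ⊑̂ v
  f̂-least s = C.HatChainSup.least (images s) (images-chain s)

  f-bounded-by-approximants : ∀ b v → (∀ p → f₀ (B.α b p) ⊑̂ v) → f₀ b ⊑̂ v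
  f-bounded-by-approximants b v ub =
    ⊑̂-trans {f₀ b} {f̂ approximants} {v} (proj₁ f-b≈f̂) (f̂-least approximants v ub)
    where
    approximants : HatCarrier B
    approximants = B.α b , B.α-chain b

    f-b≈f̂ : Poset._≈_ (Hat C) (f₀ b) (f̂ approximants)
    f-b≈f̂ = f-continuous (B.α b) (B.α-chain b) b (B.α-sup b) (f̂ approximants)
              (C.HatChainSup.isSup (images approximants) (images-chain approximants))

  f̂-least-≪ : ∀ s v → (∀ a k → a B.≪ proj₁ s k → ¬ ¬ (f₀ a ⊑̂ v)) → f̂ s ⊑̂ v
  f̂-least-≪ s v ub = f̂-least s v λ k → f-bounded-by-approximants (proj₁ s k) v λ p →
    ⊑̂-stable {f₀ (B.α (proj₁ s k) p)} {v} (ub _ k (B.α-≪ _ p))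

  f̂-mono : ∀ {s t} → Defs._⊑̂_ B s t → f̂ s ⊑̂ f̂ t
  f̂-mono {s} {t} s⊑t = f̂-least-≪ s (f̂ t) λ a k a≪ →
    ∃̃-bind (s⊑t a k a≪) λ m a≪tm a⋢ →
      a⋢ (⊑̂-trans {f₀ a} {f₀ (proj₁ t m)} {f̂ t} (f-mono (B.≪⇒⊑ a≪tm)) (f̂-upper t m))

  f̂ᵐ : Monotone (Hat B) (Hat C)
  f̂ᵐ = f̂ , λ {s} {t} → f̂-mono {s} {t}

  f̂-continuous : ScottContinuous (Hat B) (Hat C) f̂ᵐ
  f̂-continuous x x-chain s s-sup t t-sup =
    f̂s⊑t , proj₂ t-sup (f̂ s) (λ n → f̂-mono {x n} {s} (proj₁ s-sup n))
    where
    open B.HatChainSup x x-chain using (sup; sup-below; upper)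

    f̂-sup⊑t : f̂ sup ⊑̂ t
    f̂-sup⊑t = f̂-least sup t λ n → let (j , l , below) = sup-below n in
      ⊑̂-trans {f₀ (proj₁ sup n)} {f₀ (proj₁ (x j) l)} {t} (f-mono below)
        (⊑̂-trans {f₀ (proj₁ (x j) l)} {f̂ (x j)} {t} (f̂-upper (x j) l) (proj₁ t-sup j))

    f̂s⊑t : f̂ s ⊑̂ t
    f̂s⊑t = ⊑̂-trans {f̂ s} {f̂ sup} {t} (f̂-mono {s} {sup} (proj₂ s-sup sup upper)) f̂-sup⊑t

  f̂-extends : ∀ b → Poset._≈_ (Hat C) (f̂ (embed B b)) (f₀ b)
  f̂-extends b = f̂-least (embed B b) (f₀ b) (λ _ → ⊑̂-refl {f₀ b}) , f̂-upper (embed B b) 0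

proposition3p6 : (B C : Poset 0ℓ 0ℓ 0ℓ) →
    IsPredomainBase B → ConsistencyContinuous B →
    IsPredomainBase C → ConsistencyContinuous C →
    WeakInterpolation C →
    (f : Monotone B (Hat C)) → ScottContinuous B (Hat C) f →
    Σ (Monotone (Hat B) (Hat C)) (λ fh →
      ScottContinuous (Hat B) (Hat C) fh ×
      ((b : Poset.Carrier B) →
        Poset._≈_ (Hat C) (proj₁ fh (embed B b)) (proj₁ f b)))
proposition3p6 B C baseB _ baseC _ _ f f-continuous = f̂ᵐ , f̂-continuous , f̂-extends
  where open Extension B C baseB baseC f f-continuous
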